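{- Let $r$ be a positive integer and $m$ a nonnegative integer with $(m\bmod r)<\frac{r}{2}$. Then $$\frac{1}{\{m+1\}_r}\cdot\frac{\{2m\}_r!}{\{m\}_r!\,\{m\}_r!}$$ is a polynomial, i.e. lies in $\mathbb{Z}[s_1,s_2,\dots]$.
   Context: Let $s_1,s_2,\dots$ be commuting indeterminates. Here $a\bmod r\in\{0,\dots,r-1\}$ is the remainder. For $i\ge1$ let $\tau_i$ be a tile of length $i$; a tiling word of $k\ge0$ is a word $\tau_{i_1}\cdots\tau_{i_j}$ with $i_1+\cdots+i_j=k$ (the empty word for $k=0$), with weight $s_{i_1}\cdots s_{i_j}$. For $m\ge0$, $\Delta_{m,r}$ is the set of tiling words of $m$ consisting of $(m\bmod r)$ tiles $\tau_1$ followed by tiles from $\{\tau_r,\tau_{2r}\}$ in any order. The $r$-Lucas polynomials are $\{0\}_r=0$ and $\{m+1\}_r=\sum_{T\in\Delta_{m,r}}\mathrm{wt}(T)$ for $m\ge0$; $\{0\}_r!=1$ and $\{m\}_r!=\{m\}_r\cdot\{m-1\}_r!$. The displayed expression is a priori a rational function in the $s_i$. -}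

module Defs where

open import Level using (0ℓ)
open import Data.Bool using (Bool; true; false; _∧_; _∨_)
open import Data.Nat using (ℕ; zero; suc; _*_; _≡ᵇ_; NonZero)
open import Data.Nat.DivMod using (_%_)
open import Data.List using (List; []; _∷_; map; concatMap; foldr; filterᵇ)
open import Algebra.Bundles using (CommutativeRing)

-- Syntax of polynomials with integer coefficients in the commuting
-- indeterminates s_1, s_2, ... (var i stands for s_i).
infixl 6 _⊕_
infixl 7 _⊗_
data Expr : Set where
  var  : ℕ → Expr
  𝟘 𝟙  : Expr
  _⊕_  : Expr → Expr → Expr
  _⊗_  : Expr → Expr → Expr
  ⊖_   : Expr → Expr

-- Two expressions denote the same element of Z[s_1,s_2,...]
-- iff their evaluations agree in every commutative ring under every
-- assignment (Z[s_1,s_2,...] is the free commutative ring on the s_i).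
⟦_⟧ : Expr → (R : CommutativeRing 0ℓ 0ℓ) → (ℕ → CommutativeRing.Carrier R) → CommutativeRing.Carrier R
⟦ var i ⟧ R ρ = ρ i
⟦ 𝟘 ⟧ R ρ = CommutativeRing.0# R
⟦ 𝟙 ⟧ R ρ = CommutativeRing.1# R
⟦ p ⊕ q ⟧ R ρ = CommutativeRing._+_ R (⟦ p ⟧ R ρ) (⟦ q ⟧ R ρ)
⟦ p ⊗ q ⟧ R ρ = CommutativeRing._*_ R (⟦ p ⟧ R ρ) (⟦ q ⟧ R ρ)
⟦ ⊖ p ⟧ R ρ = CommutativeRing.-_ R (⟦ p ⟧ R ρ)

-- A tiling word is the list of its tile lengths (τ_i ↦ i).
-- All tiling words of k (compositions of k): every tiling word of k+1 arises
-- uniquely from one of k by prepending τ_1 or lengthening its first tile.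
tilings : ℕ → List (List ℕ)
tilings zero = [] ∷ []
tilings (suc k) = concatMap step (tilings k)
  where
  step : List ℕ → List (List ℕ)
  step [] = (1 ∷ []) ∷ []
  step (x ∷ w) = (1 ∷ x ∷ w) ∷ (suc x ∷ w) ∷ []

wt : List ℕ → Expr
wt = foldr (λ i e → var i ⊗ e) 𝟙

sumE : List Expr → Expr
sumE = foldr _⊕_ 𝟘

allᵇ : (ℕ → Bool) → List ℕ → Bool
allᵇ p = foldr (λ x b → p x ∧ b) true

inΔ : ℕ → ℕ → List ℕ → Bool
inΔ zero r w = allᵇ (λ x → (x ≡ᵇ r) ∨ (x ≡ᵇ 2 * r)) w
inΔ (suc k) r [] = false
inΔ (suc k) r (x ∷ w) = (x ≡ᵇ 1) ∧ inΔ k r w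

Δ : (m r : ℕ) → .{{NonZero r}} → List (List ℕ)
Δ m r = filterᵇ (inΔ (m % r) r) (tilings m)

lucas : (r : ℕ) → .{{NonZero r}} → ℕ → Expr
lucas r zero = 𝟘
lucas r (suc m) = sumE (map wt (Δ m r))

lucasFact : (r : ℕ) → .{{NonZero r}} → ℕ → Expr
lucasFact r zero = 𝟙
lucasFact r (suc m) = lucas r (suc m) ⊗ lucasFact r m

-- Write m = a + Q r with a = m mod r.  A tiling of m in Δ_{m,r} is a block of
-- a tiles τ_1 followed by a tiling of Q r by τ_r and τ_{2r}, so
-- {a + Q r + 1}_r = s_1^a F_{Q+1}, where F is the Fibonacci sequence
-- F_{n+2} = s_r F_{n+1} + s_{2r} F_n.  Hence {a + Q r}_r! is a power of s_1
-- times F!_Q^r F_{Q+1}^a.  For 2a < r the quotient of {2m}_r! by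
-- {m+1}_r {m}_r!² becomes a product of fibonomials F!_{2Q}/F!_Q² and
-- Fibonacci–Catalan numbers F!_{2Q}/(F_{Q+1} F!_Q²), which are polynomials
-- by the addition formula F_{x+y+1} = F_{x+1} F_{y+1} + s_{2r} F_x F_y.
module Submission where

open import Defs
open import Level using (0ℓ)
open import Data.Nat using (ℕ; suc; _*_; _<_; NonZero)
open import Data.Nat.DivMod using (_%_)
open import Data.Product using (Σ)
open import Algebra.Bundles using (CommutativeRing)
open import Data.Nat using (zero; _+_; _∸_; _≤_; _≡ᵇ_; s≤s; z<s)
import Data.Nat.Properties as ℕ
open import Data.Nat.Properties
  using (+-suc; +-commutativeSemigroup; *-distribˡ-+;
         ≡ᵇ⇒≡; ≡⇒≡ᵇ; ≤-refl; <⇒≤; <⇒≢; ≤-<-trans; m≤n⇒m≤1+n; m≤m+n; m<m+n;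
         m∸n+n≡m; suc-injective; *-monoˡ-<)
open import Algebra.Properties.CommutativeSemigroup +-commutativeSemigroup using (x∙yz≈y∙xz)
open import Data.Nat.DivMod using (_/_; m≡m%n+[m/n]*n; [m+kn]%n≡m%n; m<n⇒m%n≡m)
open import Data.Nat.Tactic.RingSolver using (solve-∀)
open import Data.Bool using (Bool; true; false; if_then_else_; _∧_; _∨_; T)
open import Data.Bool.Properties using (T-∧)
open import Data.List using (List; []; _∷_; map; _++_; concatMap; filterᵇ)
open import Data.Product using (_×_; _,_; proj₁)
open import Data.Unit using (tt)
open import Data.Empty using (⊥-elim)
open import Function using (_∘_)
open import Function.Bundles using (Equivalence)
open import Relation.Nullary using (¬_)
import Relation.Binary.PropositionalEquality as ≡
open ≡ using (_≡_; _≢_)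

triangle : ℕ → ℕ
triangle zero    = 0
triangle (suc n) = n + triangle n

triangle-double : ∀ a → triangle (a + a) ≡ 4 * triangle a + a
triangle-double zero = ≡.refl
triangle-double (suc a) rewrite +-suc a a | triangle-double a = arith a (triangle a)
  where
  arith : ∀ a t → suc (a + a) + ((a + a) + (4 * t + a)) ≡ 4 * (a + t) + suc a
  arith = solve-∀

s₁-exponent : ∀ a Q n → 2 * Q * n + triangle (2 * a)
                        ≡ (triangle a + triangle a) + (a + ((Q * n + triangle a) + (Q * n + triangle a)))
s₁-exponent a Q n
  rewrite ≡.cong triangle (≡.cong (a +_) (ℕ.+-identityʳ a)) | triangle-double a = arith Q n a (triangle a)
  where
  arith : ∀ Q n a t → 2 * Q * n + (4 * t + a) ≡ (t + t) + (a + ((Q * n + t) + (Q * n + t)))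
  arith = solve-∀

infixr 8 _^ᴱ_
_^ᴱ_ : Expr → ℕ → Expr
e ^ᴱ zero  = 𝟙
e ^ᴱ suc n = e ⊗ e ^ᴱ n

module Fibonacci (s t : Expr) where

  fib : ℕ → Expr
  fib zero          = 𝟘
  fib (suc zero)    = 𝟙
  fib (suc (suc n)) = s ⊗ fib (suc n) ⊕ t ⊗ fib n

  fibFact : ℕ → Expr
  fibFact zero    = 𝟙
  fibFact (suc n) = fib (suc n) ⊗ fibFact n

  -- fibFact (a + b) / (fibFact a · fibFact b); the recursion splits
  -- fib (a + b + 2) by the addition formula.
  fibonomial : ℕ → ℕ → Expr
  fibonomial zero    b       = 𝟙
  fibonomial (suc a) zero    = 𝟙
  fibonomial (suc a) (suc b) =
    fib (suc (suc a)) ⊗ fibonomial (suc a) b ⊕ t ⊗ (fib b ⊗ fibonomial a (suc b))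

  -- fibFact (2Q) / (fib (Q + 1) · fibFact Q²)
  fibCatalan : ℕ → Expr
  fibCatalan zero          = 𝟙
  fibCatalan (suc zero)    = 𝟙
  fibCatalan (suc (suc q)) =
    fibonomial (suc q) (suc (suc q)) ⊕ t ⊗ fibonomial q (suc (suc (suc q)))

quotientWitness : (r a Q : ℕ) → Expr
quotientWitness r a Q =
  var 1 ^ᴱ (triangle a + triangle a) ⊗ fib (suc (2 * Q)) ^ᴱ (2 * a)
    ⊗ fibonomial Q Q ^ᴱ (r ∸ suc (2 * a)) ⊗ fibCatalan Q ^ᴱ suc (2 * a)
  where open Fibonacci (var r) (var (2 * r))

module _ (R : CommutativeRing 0ℓ 0ℓ) where
  open CommutativeRing R renaming (_+_ to _⊞_; _*_ to _⊠_)
  open import Algebra.Properties.Semiring.Exp semiring using (_^_; ^-congˡ; ^-congʳ; ^-homo-*)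
  open import Algebra.Properties.CommutativeSemiring.Exp commutativeSemiring using (^-distrib-*)
  open import Algebra.Solver.Ring.NaturalCoefficients.Default commutativeSemiring
    using (solve; _:=_; _:+_; _:*_; con)
  open import Relation.Binary.Reasoning.Setoid setoid

  1#^n≈1# : ∀ n → 1# ^ n ≈ 1#
  1#^n≈1# zero    = refl
  1#^n≈1# (suc n) = trans (*-identityˡ _) (1#^n≈1# n)

  powers-of-quotients : ∀ {g c x y z} k n → g ⊠ x ⊠ x ≈ z → c ⊠ y ⊠ x ⊠ x ≈ z →
    z ^ (k + n) ≈ (g ^ k ⊠ c ^ n) ⊠ (x ^ (k + n) ⊠ x ^ (k + n)) ⊠ y ^ n
  powers-of-quotients {g} {c} {x} {y} {z} k n gxx≈z cyxx≈z = begin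
    z ^ (k + n)
      ≈⟨ ^-homo-* z k n ⟩
    z ^ k ⊠ z ^ n
      ≈⟨ *-cong (^-congˡ k (sym gxx≈z)) (^-congˡ n (sym cyxx≈z)) ⟩
    (g ⊠ x ⊠ x) ^ k ⊠ (c ⊠ y ⊠ x ⊠ x) ^ n
      ≈⟨ *-cong (^-distrib-*₃ g x x k)
                (trans (^-distrib-*₃ (c ⊠ y) x x n) (*-congʳ (*-congʳ (^-distrib-* c y n)))) ⟩
    g ^ k ⊠ x ^ k ⊠ x ^ k ⊠ (c ^ n ⊠ y ^ n ⊠ x ^ n ⊠ x ^ n)
      ≈⟨ solve 5 (λ gk xk cn yn xn → gk :* xk :* xk :* (cn :* yn :* xn :* xn)
                                   := (gk :* cn) :* ((xk :* xn) :* (xk :* xn)) :* yn)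
               refl (g ^ k) (x ^ k) (c ^ n) (y ^ n) (x ^ n) ⟩
    (g ^ k ⊠ c ^ n) ⊠ ((x ^ k ⊠ x ^ n) ⊠ (x ^ k ⊠ x ^ n)) ⊠ y ^ n
      ≈⟨ *-congʳ (*-congˡ (sym (*-cong (^-homo-* x k n) (^-homo-* x k n)))) ⟩
    (g ^ k ⊠ c ^ n) ⊠ (x ^ (k + n) ⊠ x ^ (k + n)) ⊠ y ^ n
      ∎
    where
    ^-distrib-*₃ : ∀ u v w m → (u ⊠ v ⊠ w) ^ m ≈ u ^ m ⊠ v ^ m ⊠ w ^ m
    ^-distrib-*₃ u v w m = trans (^-distrib-* (u ⊠ v) w m) (*-congʳ (^-distrib-* u v m))

  ^-s₁-exponent : ∀ x a Q n → let e = Q * n + triangle a in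
    x ^ (triangle a + triangle a) ⊠ (x ^ a ⊠ (x ^ e ⊠ x ^ e)) ≈ x ^ (2 * Q * n + triangle (2 * a))
  ^-s₁-exponent x a Q n = begin
    x ^ (triangle a + triangle a) ⊠ (x ^ a ⊠ (x ^ e ⊠ x ^ e))
      ≈⟨ *-congˡ (*-congˡ (sym (^-homo-* x e e))) ⟩
    x ^ (triangle a + triangle a) ⊠ (x ^ a ⊠ x ^ (e + e))
      ≈⟨ *-congˡ (sym (^-homo-* x a (e + e))) ⟩
    x ^ (triangle a + triangle a) ⊠ x ^ (a + (e + e))
      ≈⟨ sym (^-homo-* x (triangle a + triangle a) (a + (e + e))) ⟩
    x ^ ((triangle a + triangle a) + (a + (e + e)))
      ≈⟨ ^-congʳ x (≡.sym (s₁-exponent a Q n)) ⟩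
    x ^ (2 * Q * n + triangle (2 * a))
      ∎
    where
    e : ℕ
    e = Q * n + triangle a

  ∑ : {A : Set} → List A → (A → Carrier) → Carrier
  ∑ []       f = 0#
  ∑ (x ∷ xs) f = f x ⊞ ∑ xs f

  ∑-cong : ∀ {A} (xs : List A) {f g} → (∀ x → f x ≈ g x) → ∑ xs f ≈ ∑ xs g
  ∑-cong []       f≈g = refl
  ∑-cong (x ∷ xs) f≈g = +-cong (f≈g x) (∑-cong xs f≈g)

  ∑-++ : ∀ {A} (xs ys : List A) f → ∑ (xs ++ ys) f ≈ ∑ xs f ⊞ ∑ ys f
  ∑-++ []       ys f = sym (+-identityˡ _)
  ∑-++ (x ∷ xs) ys f = trans (+-congˡ (∑-++ xs ys f)) (sym (+-assoc _ _ _))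

  ∑-concatMap : ∀ {A B} (g : A → List B) f h → (∀ x → ∑ (g x) f ≈ h x) →
                ∀ xs → ∑ (concatMap g xs) f ≈ ∑ xs h
  ∑-concatMap g f h gf≈h []       = refl
  ∑-concatMap g f h gf≈h (x ∷ xs) =
    trans (∑-++ (g x) (concatMap g xs) f) (+-cong (gf≈h x) (∑-concatMap g f h gf≈h xs))

  ∑-distrib-⊞ : ∀ {A} (xs : List A) f g → ∑ xs (λ x → f x ⊞ g x) ≈ ∑ xs f ⊞ ∑ xs g
  ∑-distrib-⊞ []       f g = sym (+-identityˡ 0#)
  ∑-distrib-⊞ (x ∷ xs) f g = trans (+-congˡ (∑-distrib-⊞ xs f g))
    (solve 4 (λ a b c d → a :+ b :+ (c :+ d) := a :+ c :+ (b :+ d)) refl (f x) (g x) (∑ xs f) (∑ xs g))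

  ∑-distribˡ : ∀ {A} (xs : List A) c f → ∑ xs (λ x → c ⊠ f x) ≈ c ⊠ ∑ xs f
  ∑-distribˡ []       c f = sym (zeroʳ c)
  ∑-distribˡ (x ∷ xs) c f = trans (+-congˡ (∑-distribˡ xs c f)) (sym (distribˡ c _ _))

  lengthenFirst : (List ℕ → Carrier) → List ℕ → Carrier
  lengthenFirst f []      = 0#
  lengthenFirst f (x ∷ w) = f (suc x ∷ w)

  ∑-tilings-suc : ∀ k f → ∑ (tilings (suc k)) f ≈ ∑ (tilings k) (λ w → f (1 ∷ w) ⊞ lengthenFirst f w)
  ∑-tilings-suc k f = ∑-concatMap _ f _ (λ { [] → refl ; (x ∷ w) → +-congˡ (+-identityʳ _) }) (tilings k)

  ∑-tilings-suc-cong : ∀ k {f g} → (∀ x w → f (x ∷ w) ≈ g (x ∷ w)) →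
                       ∑ (tilings (suc k)) f ≈ ∑ (tilings (suc k)) g
  ∑-tilings-suc-cong k {f} {g} f≈g = begin
    ∑ (tilings (suc k)) f
      ≈⟨ ∑-tilings-suc k f ⟩
    ∑ (tilings k) (λ w → f (1 ∷ w) ⊞ lengthenFirst f w)
      ≈⟨ ∑-cong (tilings k) (λ { []      → +-congʳ (f≈g 1 [])
                               ; (x ∷ w) → +-cong (f≈g 1 (x ∷ w)) (f≈g (suc x) w) }) ⟩
    ∑ (tilings k) (λ w → g (1 ∷ w) ⊞ lengthenFirst g w)
      ≈⟨ sym (∑-tilings-suc k g) ⟩
    ∑ (tilings (suc k)) g
      ∎

  firstTile : (ℕ → Carrier) → (List ℕ → Carrier) → List ℕ → Carrier
  firstTile c B []      = 0#
  firstTile c B (x ∷ w) = c x ⊠ B w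

  ∑-firstTile-suc : ∀ k c B → ∑ (tilings (suc k)) (firstTile c B)
                              ≈ c 1 ⊠ ∑ (tilings k) B ⊞ ∑ (tilings k) (firstTile (c ∘ suc) B)
  ∑-firstTile-suc k c B = begin
    ∑ (tilings (suc k)) (firstTile c B)
      ≈⟨ ∑-tilings-suc k (firstTile c B) ⟩
    ∑ (tilings k) (λ w → c 1 ⊠ B w ⊞ lengthenFirst (firstTile c B) w)
      ≈⟨ ∑-cong (tilings k) (λ { [] → refl ; (x ∷ w) → refl }) ⟩
    ∑ (tilings k) (λ w → c 1 ⊠ B w ⊞ firstTile (c ∘ suc) B w)
      ≈⟨ ∑-distrib-⊞ (tilings k) _ (firstTile (c ∘ suc) B) ⟩
    ∑ (tilings k) (λ w → c 1 ⊠ B w) ⊞ ∑ (tilings k) (firstTile (c ∘ suc) B)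
      ≈⟨ +-congʳ (∑-distribˡ (tilings k) (c 1) B) ⟩
    c 1 ⊠ ∑ (tilings k) B ⊞ ∑ (tilings k) (firstTile (c ∘ suc) B)
      ∎

  ∑-firstTile-vanishing : ∀ k c B → (∀ x → x < k → c (suc x) ≈ 0#) → ∑ (tilings k) (firstTile c B) ≈ 0#
  ∑-firstTile-vanishing zero    c B c≈0 = +-identityʳ 0#
  ∑-firstTile-vanishing (suc k) c B c≈0 = begin
    ∑ (tilings (suc k)) (firstTile c B)
      ≈⟨ ∑-firstTile-suc k c B ⟩
    c 1 ⊠ ∑ (tilings k) B ⊞ ∑ (tilings k) (firstTile (c ∘ suc) B)
      ≈⟨ +-cong (trans (*-congʳ (c≈0 0 z<s)) (zeroˡ _))
                (∑-firstTile-vanishing k (c ∘ suc) B (λ x x<k → c≈0 (suc x) (s≤s x<k))) ⟩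
    0# ⊞ 0#
      ≈⟨ +-identityʳ 0# ⟩
    0#
      ∎

  ∑-firstTile-single : ∀ j k c B → (∀ x → x ≢ suc j → c x ≈ 0#) →
                       ∑ (tilings (suc (j + k))) (firstTile c B) ≈ c (suc j) ⊠ ∑ (tilings k) B
  ∑-firstTile-single zero k c B c≈0 = begin
    ∑ (tilings (suc k)) (firstTile c B)
      ≈⟨ ∑-firstTile-suc k c B ⟩
    c 1 ⊠ ∑ (tilings k) B ⊞ ∑ (tilings k) (firstTile (c ∘ suc) B)
      ≈⟨ +-congˡ (∑-firstTile-vanishing k (c ∘ suc) B (λ x _ → c≈0 (suc (suc x)) (λ ()))) ⟩
    c 1 ⊠ ∑ (tilings k) B ⊞ 0#
      ≈⟨ +-identityʳ _ ⟩
    c 1 ⊠ ∑ (tilings k) B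
      ∎
  ∑-firstTile-single (suc j) k c B c≈0 = begin
    ∑ (tilings (suc (suc j + k))) (firstTile c B)
      ≈⟨ ∑-firstTile-suc (suc (j + k)) c B ⟩
    c 1 ⊠ ∑ (tilings (suc (j + k))) B ⊞ ∑ (tilings (suc (j + k))) (firstTile (c ∘ suc) B)
      ≈⟨ +-cong (trans (*-congʳ (c≈0 1 (λ ()))) (zeroˡ _))
                (∑-firstTile-single j k (c ∘ suc) B (λ x x≢ → c≈0 (suc x) (x≢ ∘ suc-injective))) ⟩
    0# ⊞ c (suc (suc j)) ⊠ ∑ (tilings k) B
      ≈⟨ +-identityˡ _ ⟩
    c (suc (suc j)) ⊠ ∑ (tilings k) B
      ∎

  guard : Bool → Carrier → Carrier
  guard b x = if b then x else 0#

  guard-∧ : ∀ b c x y → guard (b ∧ c) (x ⊠ y) ≈ guard b x ⊠ guard c y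
  guard-∧ true  true  x y = refl
  guard-∧ true  false x y = sym (zeroʳ x)
  guard-∧ false c     x y = sym (zeroˡ _)

  guard-∨ : ∀ b c x → ¬ T (b ∧ c) → guard (b ∨ c) x ≈ guard b x ⊞ guard c x
  guard-∨ true  true  x both = ⊥-elim (both tt)
  guard-∨ true  false x _    = sym (+-identityʳ x)
  guard-∨ false c     x _    = sym (+-identityˡ _)

  module _ (ρ : ℕ → Carrier) where

    ⟪_⟫ : Expr → Carrier
    ⟪ e ⟫ = ⟦ e ⟧ R ρ

    ⟪^ᴱ⟫ : ∀ e n → ⟪ e ^ᴱ n ⟫ ≈ ⟪ e ⟫ ^ n
    ⟪^ᴱ⟫ e zero    = refl
    ⟪^ᴱ⟫ e (suc n) = *-congˡ (⟪^ᴱ⟫ e n)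

    ⟪sumE-filter⟫ : ∀ p ws → ⟪ sumE (map wt (filterᵇ p ws)) ⟫ ≈ ∑ ws (λ w → guard (p w) ⟪ wt w ⟫)
    ⟪sumE-filter⟫ p []       = refl
    ⟪sumE-filter⟫ p (w ∷ ws) with p w
    ... | true  = +-congˡ (⟪sumE-filter⟫ p ws)
    ... | false = trans (⟪sumE-filter⟫ p ws) (sym (+-identityˡ _))

    tile : ℕ → ℕ → Carrier
    tile p x = guard (x ≡ᵇ p) (ρ x)

    tile-≢ : ∀ {p x} → x ≢ p → tile p x ≈ 0#
    tile-≢ {p} {x} x≢p with x ≡ᵇ p in eq
    ... | true  = ⊥-elim (x≢p (≡ᵇ⇒≡ x p (≡.subst T (≡.sym eq) tt)))
    ... | false = refl

    tile-≡ : ∀ {p x} → x ≡ p → tile p x ≈ ρ p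
    tile-≡ {p} ≡.refl with p ≡ᵇ p in eq
    ... | true  = refl
    ... | false = ⊥-elim (≡.subst T eq (≡⇒≡ᵇ p p ≡.refl))

    module FibonacciEvaluation (s t : Expr) where
      open Fibonacci s t

      F fact : ℕ → Carrier
      F n    = ⟪ fib n ⟫
      fact n = ⟪ fibFact n ⟫

      fib-+ : ∀ x y → F (suc (x + y)) ≈ F (suc x) ⊠ F (suc y) ⊞ ⟪ t ⟫ ⊠ F x ⊠ F y
      fib-+ zero    y = solve 3 (λ u v w → u := con 1 :* u :+ v :* con 0 :* w) refl (F (suc y)) ⟪ t ⟫ (F y)
      fib-+ (suc x) y = begin
        F (suc (suc (x + y)))
          ≈⟨ reflexive (≡.cong (F ∘ suc) (≡.sym (+-suc x y))) ⟩
        F (suc (x + suc y))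
          ≈⟨ fib-+ x (suc y) ⟩
        F (suc x) ⊠ F (suc (suc y)) ⊞ ⟪ t ⟫ ⊠ F x ⊠ F (suc y)
          ≈⟨ solve 6 (λ a b c d u v → a :* (v :* c :+ u :* d) :+ u :* b :* c
                                    := (v :* a :+ u :* b) :* c :+ u :* a :* d)
                   refl (F (suc x)) (F x) (F (suc y)) (F y) ⟪ t ⟫ ⟪ s ⟫ ⟩
        F (suc (suc x)) ⊠ F (suc y) ⊞ ⟪ t ⟫ ⊠ F (suc x) ⊠ F y
          ∎

      fibonomial-fibFact : ∀ a b → ⟪ fibonomial a b ⟫ ⊠ fact a ⊠ fact b ≈ fact (a + b)
      fibonomial-fibFact zero    b    = solve 1 (λ u → con 1 :* con 1 :* u := u) refl (fact b)
      fibonomial-fibFact (suc a) zero =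
        trans (solve 1 (λ u → con 1 :* u :* con 1 := u) refl (fact (suc a)))
              (reflexive (≡.cong fact (≡.sym (ℕ.+-identityʳ (suc a)))))
      fibonomial-fibFact (suc a) (suc b) = begin
        (F (suc (suc a)) ⊠ G (suc a) b ⊞ ⟪ t ⟫ ⊠ (F b ⊠ G a (suc b))) ⊠ fact (suc a) ⊠ fact (suc b)
          ≈⟨ solve 9 (λ f₂ g₁ u f₀ g₂ f₁ fa f₁′ fb →
                (f₂ :* g₁ :+ u :* (f₀ :* g₂)) :* (f₁ :* fa) :* (f₁′ :* fb)
             := f₂ :* f₁′ :* (g₁ :* (f₁ :* fa) :* fb) :+ u :* f₁ :* f₀ :* (g₂ :* fa :* (f₁′ :* fb)))
               refl (F (suc (suc a))) (G (suc a) b) ⟪ t ⟫ (F b) (G a (suc b)) (F (suc a)) (fact a) (F (suc b)) (fact b) ⟩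
        F (suc (suc a)) ⊠ F (suc b) ⊠ (G (suc a) b ⊠ fact (suc a) ⊠ fact b)
          ⊞ ⟪ t ⟫ ⊠ F (suc a) ⊠ F b ⊠ (G a (suc b) ⊠ fact a ⊠ fact (suc b))
          ≈⟨ +-cong (*-congˡ (fibonomial-fibFact (suc a) b))
                    (*-congˡ (trans (fibonomial-fibFact a (suc b)) (reflexive (≡.cong fact (+-suc a b))))) ⟩
        F (suc (suc a)) ⊠ F (suc b) ⊠ fact (suc (a + b)) ⊞ ⟪ t ⟫ ⊠ F (suc a) ⊠ F b ⊠ fact (suc (a + b))
          ≈⟨ sym (distribʳ _ _ _) ⟩
        (F (suc (suc a)) ⊠ F (suc b) ⊞ ⟪ t ⟫ ⊠ F (suc a) ⊠ F b) ⊠ fact (suc (a + b))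
          ≈⟨ *-congʳ (sym (fib-+ (suc a) b)) ⟩
        fact (suc (suc a + b))
          ≈⟨ reflexive (≡.cong fact (≡.sym (≡.cong suc (+-suc a b)))) ⟩
        fact (suc a + suc b)
          ∎
        where
        G : ℕ → ℕ → Carrier
        G a b = ⟪ fibonomial a b ⟫

      fibCatalan-fibFact : ∀ Q → ⟪ fibCatalan Q ⟫ ⊠ F (suc Q) ⊠ fact Q ⊠ fact Q ≈ fact (Q + Q)
      fibCatalan-fibFact zero          = solve 0 (con 1 :* con 1 :* con 1 :* con 1 := con 1) refl
      fibCatalan-fibFact (suc zero)    = solve 1 (λ f → con 1 :* f :* (con 1 :* con 1) :* (con 1 :* con 1)
                                                        := f :* (con 1 :* con 1)) refl (F 2)
      fibCatalan-fibFact (suc (suc q)) = begin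
        (G₁ ⊞ ⟪ t ⟫ ⊠ G₂) ⊠ F₃ ⊠ fact (suc (suc q)) ⊠ fact (suc (suc q))
          ≈⟨ solve 7 (λ g₁ g₂ u f₁ f₂ f₃ fq →
                (g₁ :+ u :* g₂) :* f₃ :* (f₂ :* (f₁ :* fq)) :* (f₂ :* (f₁ :* fq))
             := f₃ :* f₂ :* (g₁ :* (f₁ :* fq) :* (f₂ :* (f₁ :* fq)))
                :+ u :* f₂ :* f₁ :* (g₂ :* fq :* (f₃ :* (f₂ :* (f₁ :* fq)))))
               refl G₁ G₂ ⟪ t ⟫ F₁ F₂ F₃ (fact q) ⟩
        F₃ ⊠ F₂ ⊠ (G₁ ⊠ fact (suc q) ⊠ fact (suc (suc q)))
          ⊞ ⟪ t ⟫ ⊠ F₂ ⊠ F₁ ⊠ (G₂ ⊠ fact q ⊠ fact (suc (suc (suc q))))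
          ≈⟨ +-cong (*-congˡ (trans (fibonomial-fibFact (suc q) (suc (suc q))) (reflexive (≡.cong fact e₁))))
                    (*-congˡ (trans (fibonomial-fibFact q (suc (suc (suc q)))) (reflexive (≡.cong fact e₂)))) ⟩
        F₃ ⊠ F₂ ⊠ X ⊞ ⟪ t ⟫ ⊠ F₂ ⊠ F₁ ⊠ X
          ≈⟨ sym (distribʳ X _ _) ⟩
        (F₃ ⊠ F₂ ⊞ ⟪ t ⟫ ⊠ F₂ ⊠ F₁) ⊠ X
          ≈⟨ *-congʳ (trans (sym (fib-+ (suc (suc q)) (suc q))) (reflexive (≡.cong F e₃))) ⟩
        fact (suc (suc (suc (suc (q + q)))))
          ≈⟨ reflexive (≡.cong fact (≡.sym (≡.cong suc e₁))) ⟩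
        fact (suc (suc q) + suc (suc q))
          ∎
        where
        G₁ G₂ F₁ F₂ F₃ X : Carrier
        G₁ = ⟪ fibonomial (suc q) (suc (suc q)) ⟫
        G₂ = ⟪ fibonomial q (suc (suc (suc q))) ⟫
        F₁ = F (suc q)
        F₂ = F (suc (suc q))
        F₃ = F (suc (suc (suc q)))
        X  = fact (suc (suc (suc (q + q))))
        e₁ : suc q + suc (suc q) ≡ suc (suc (suc (q + q)))
        e₁ = ≡.cong suc (≡.trans (+-suc q (suc q)) (≡.cong suc (+-suc q q)))
        e₂ : q + suc (suc (suc q)) ≡ suc (suc (suc (q + q)))
        e₂ = ≡.trans (+-suc q _) e₁
        e₃ : suc (suc (suc q) + suc q) ≡ suc (suc (suc (suc (q + q))))
        e₃ = ≡.cong (suc ∘ suc ∘ suc) (+-suc q q)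

      fibFact-double-power : ∀ Q k n → fact (2 * Q) ^ (k + n)
        ≈ (⟪ fibonomial Q Q ⟫ ^ k ⊠ ⟪ fibCatalan Q ⟫ ^ n) ⊠ (fact Q ^ (k + n) ⊠ fact Q ^ (k + n)) ⊠ F (suc Q) ^ n
      fibFact-double-power Q k n =
        powers-of-quotients k n (trans (fibonomial-fibFact Q Q) (sym fact2Q)) (trans (fibCatalan-fibFact Q) (sym fact2Q))
        where
        fact2Q : fact (2 * Q) ≈ fact (Q + Q)
        fact2Q = reflexive (≡.cong (fact ∘ (Q +_)) (ℕ.+-identityʳ Q))

    module LucasEvaluation (r-1 : ℕ) where
      r : ℕ
      r = suc r-1

      open Fibonacci (var r) (var (2 * r))
      open FibonacciEvaluation (var r) (var (2 * r))

      weightIn : ℕ → List ℕ → Carrier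
      weightIn a w = guard (inΔ a r w) ⟪ wt w ⟫

      ⟪lucas⟫ : ∀ m → ⟪ lucas r (suc m) ⟫ ≈ ∑ (tilings m) (weightIn (m % r))
      ⟪lucas⟫ m = ⟪sumE-filter⟫ (inΔ (m % r) r) (tilings m)

      weightIn-suc : ∀ a w → weightIn (suc a) w ≈ firstTile (tile 1) (weightIn a) w
      weightIn-suc a []      = refl
      weightIn-suc a (x ∷ w) = guard-∧ (x ≡ᵇ 1) (inΔ a r w) (ρ x) ⟪ wt w ⟫

      rTilings : ℕ → Carrier
      rTilings k = ∑ (tilings k) (weightIn 0)

      ∑-weightIn : ∀ a k → ∑ (tilings (a + k)) (weightIn a) ≈ ρ 1 ^ a ⊠ rTilings k
      ∑-weightIn zero    k = sym (*-identityˡ _)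
      ∑-weightIn (suc a) k = begin
        ∑ (tilings (suc (a + k))) (weightIn (suc a))
          ≈⟨ ∑-cong (tilings (suc (a + k))) (weightIn-suc a) ⟩
        ∑ (tilings (suc (a + k))) (firstTile (tile 1) (weightIn a))
          ≈⟨ ∑-firstTile-single 0 (a + k) (tile 1) (weightIn a) (λ x → tile-≢) ⟩
        ρ 1 ⊠ ∑ (tilings (a + k)) (weightIn a)
          ≈⟨ *-congˡ (∑-weightIn a k) ⟩
        ρ 1 ⊠ (ρ 1 ^ a ⊠ rTilings k)
          ≈⟨ sym (*-assoc _ _ _) ⟩
        ρ 1 ^ suc a ⊠ rTilings k
          ∎

      r<2r : r < 2 * r
      r<2r = m<m+n r z<s

      distinct-tiles : ∀ x → ¬ T ((x ≡ᵇ r) ∧ (x ≡ᵇ 2 * r))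
      distinct-tiles x both =
        let (x≡r , x≡2r) = Equivalence.to T-∧ both
        in <⇒≢ r<2r (≡.trans (≡.sym (≡ᵇ⇒≡ x r x≡r)) (≡ᵇ⇒≡ x (2 * r) x≡2r))

      rTilings-suc : ∀ k → rTilings (suc k) ≈ ∑ (tilings (suc k)) (firstTile (tile r) (weightIn 0))
                                               ⊞ ∑ (tilings (suc k)) (firstTile (tile (2 * r)) (weightIn 0))
      rTilings-suc k = trans
        (∑-tilings-suc-cong k (λ x w →
          trans (guard-∧ ((x ≡ᵇ r) ∨ (x ≡ᵇ 2 * r)) (inΔ 0 r w) (ρ x) ⟪ wt w ⟫)
                (trans (*-congʳ (guard-∨ (x ≡ᵇ r) (x ≡ᵇ 2 * r) (ρ x) (distinct-tiles x))) (distribʳ _ _ _))))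
        (∑-distrib-⊞ (tilings (suc k)) (firstTile (tile r) (weightIn 0)) (firstTile (tile (2 * r)) (weightIn 0)))

      ∑-tile-single : ∀ j k p → p ≡ suc j → ∀ {n} → n ≡ j + k →
                      ∑ (tilings (suc n)) (firstTile (tile p) (weightIn 0)) ≈ ρ p ⊠ rTilings k
      ∑-tile-single j k p p≡1+j ≡.refl =
        trans (∑-firstTile-single j k (tile p) (weightIn 0)
                 (λ x x≢1+j → tile-≢ (λ x≡p → x≢1+j (≡.trans x≡p p≡1+j))))
              (*-congʳ (tile-≡ (≡.sym p≡1+j)))

      rTilings-fib : ∀ q → rTilings (q * r) ≈ F (suc q) × rTilings (suc q * r) ≈ F (suc (suc q))
      rTilings-fib zero = +-identityʳ 1# , (begin
        rTilings (r + 0)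
          ≈⟨ rTilings-suc (r-1 + 0) ⟩
        _ ⊞ ∑ (tilings (suc (r-1 + 0))) (firstTile (tile (2 * r)) (weightIn 0))
          ≈⟨ +-cong (∑-tile-single r-1 0 r ≡.refl ≡.refl)
                    (∑-firstTile-vanishing (r + 0) (tile (2 * r)) (weightIn 0)
                       (λ x x<r → tile-≢ (<⇒≢ (≤-<-trans x<r 1r<2r)))) ⟩
        ρ r ⊠ (1# ⊞ 0#) ⊞ 0#
          ≈⟨ +-cong (*-congˡ (+-identityʳ 1#)) (sym (zeroʳ _)) ⟩
        F 2
          ∎)
        where
        1r<2r : 1 * r < 2 * r
        1r<2r = *-monoˡ-< r {1} {2} ≤-refl
      rTilings-fib (suc q) =
        let (ih₀ , ih₁) = rTilings-fib q
        in ih₁ , trans (rTilings-suc (r-1 + suc q * r))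
                       (+-cong (trans (∑-tile-single r-1 (suc q * r) r ≡.refl ≡.refl) (*-congˡ ih₁))
                               (trans (∑-tile-single (r-1 + r) (q * r) (2 * r) 2r≡ (≡.sym (ℕ.+-assoc r-1 r (q * r))))
                                      (*-congˡ ih₀)))
        where
        2r≡ : 2 * r ≡ suc (r-1 + r)
        2r≡ = ≡.cong (suc ∘ (r-1 +_)) (ℕ.+-identityʳ r)

      lucas-value : ∀ a Q → a < r → ⟪ lucas r (suc (a + Q * r)) ⟫ ≈ ρ 1 ^ a ⊠ F (suc Q)
      lucas-value a Q a<r = begin
        ⟪ lucas r (suc (a + Q * r)) ⟫
          ≈⟨ ⟪lucas⟫ (a + Q * r) ⟩
        ∑ (tilings (a + Q * r)) (weightIn ((a + Q * r) % r))
          ≈⟨ reflexive (≡.cong (λ b → ∑ (tilings (a + Q * r)) (weightIn b))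
                               (≡.trans ([m+kn]%n≡m%n a Q r) (m<n⇒m%n≡m a<r))) ⟩
        ∑ (tilings (a + Q * r)) (weightIn a)
          ≈⟨ ∑-weightIn a (Q * r) ⟩
        ρ 1 ^ a ⊠ rTilings (Q * r)
          ≈⟨ *-congˡ (proj₁ (rTilings-fib Q)) ⟩
        ρ 1 ^ a ⊠ F (suc Q)
          ∎

      lucasFact-value : ∀ Q a → a ≤ r →
        ⟪ lucasFact r (a + Q * r) ⟫ ≈ ρ 1 ^ (Q * triangle r + triangle a) ⊠ (fact Q ^ r ⊠ F (suc Q) ^ a)
      lucasFact-value zero zero _ = sym (trans (*-identityˡ _) (trans (*-identityʳ _) (1#^n≈1# r)))
      lucasFact-value Q (suc a) (s≤s a≤r-1) = begin
        ⟪ lucas r (suc (a + Q * r)) ⟫ ⊠ ⟪ lucasFact r (a + Q * r) ⟫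
          ≈⟨ *-cong (lucas-value a Q (s≤s a≤r-1)) (lucasFact-value Q a (m≤n⇒m≤1+n a≤r-1)) ⟩
        (ρ 1 ^ a ⊠ F (suc Q)) ⊠ (ρ 1 ^ e ⊠ (fact Q ^ r ⊠ F (suc Q) ^ a))
          ≈⟨ solve 5 (λ p l q fr la → (p :* l) :* (q :* (fr :* la)) := (p :* q) :* (fr :* (l :* la)))
                   refl (ρ 1 ^ a) (F (suc Q)) (ρ 1 ^ e) (fact Q ^ r) (F (suc Q) ^ a) ⟩
        (ρ 1 ^ a ⊠ ρ 1 ^ e) ⊠ (fact Q ^ r ⊠ F (suc Q) ^ suc a)
          ≈⟨ *-congʳ (trans (sym (^-homo-* (ρ 1) a e))
                            (^-congʳ (ρ 1) (x∙yz≈y∙xz a (Q * triangle r) (triangle a)))) ⟩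
        ρ 1 ^ (Q * triangle r + triangle (suc a)) ⊠ (fact Q ^ r ⊠ F (suc Q) ^ suc a)
          ∎
        where
        e : ℕ
        e = Q * triangle r + triangle a
      lucasFact-value (suc Q) zero _ = begin
        ⟪ lucasFact r (r + Q * r) ⟫
          ≈⟨ lucasFact-value Q r ≤-refl ⟩
        ρ 1 ^ (Q * triangle r + triangle r) ⊠ (fact Q ^ r ⊠ F (suc Q) ^ r)
          ≈⟨ *-cong (^-congʳ (ρ 1) (≡.trans (ℕ.+-comm (Q * triangle r) (triangle r)) (≡.sym (ℕ.+-identityʳ _))))
                    (trans (*-comm _ _) (trans (sym (^-distrib-* (F (suc Q)) (fact Q) r)) (sym (*-identityʳ _)))) ⟩
        ρ 1 ^ (suc Q * triangle r + 0) ⊠ (fact (suc Q) ^ r ⊠ 1#)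
          ∎

      quotientWitness-spec : ∀ a Q {m} → m ≡ a + Q * r → 2 * a < r →
        ⟪ quotientWitness r a Q ⊗ (lucas r (suc m) ⊗ (lucasFact r m ⊗ lucasFact r m)) ⟫ ≈ ⟪ lucasFact r (2 * m) ⟫
      quotientWitness-spec a Q ≡.refl 2a<r = begin
        ⟪ quotientWitness r a Q ⟫ ⊠ (⟪ lucas r (suc m) ⟫ ⊠ (⟪ lucasFact r m ⟫ ⊠ ⟪ lucasFact r m ⟫))
          ≈⟨ *-cong (*-cong (*-cong (*-cong (⟪^ᴱ⟫ (var 1) (triangle a + triangle a)) (⟪^ᴱ⟫ (fib (suc (2 * Q))) (2 * a)))
                                    (⟪^ᴱ⟫ (fibonomial Q Q) k))
                            (⟪^ᴱ⟫ (fibCatalan Q) n))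
                    (*-cong (lucas-value a Q a<r) (*-cong L-value L-value)) ⟩
        s₀ ⊠ M ⊠ Gk ⊠ Cn ⊠ ((sa ⊠ F₁) ⊠ ((se ⊠ (fr ⊠ Fa)) ⊠ (se ⊠ (fr ⊠ Fa))))
          ≈⟨ solve 9 (λ s₀ M Gk Cn sa F₁ se fr Fa →
                s₀ :* M :* Gk :* Cn :* ((sa :* F₁) :* ((se :* (fr :* Fa)) :* (se :* (fr :* Fa))))
             := (s₀ :* (sa :* (se :* se))) :* ((Gk :* Cn) :* (fr :* fr) :* (F₁ :* (Fa :* Fa)) :* M))
               refl s₀ M Gk Cn sa F₁ se fr Fa ⟩
        (s₀ ⊠ (sa ⊠ (se ⊠ se))) ⊠ ((Gk ⊠ Cn) ⊠ (fr ⊠ fr) ⊠ (F₁ ⊠ (Fa ⊠ Fa)) ⊠ M)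
          ≈⟨ *-cong (^-s₁-exponent (ρ 1) a Q (triangle r)) (*-congʳ (sym fact2Q^r)) ⟩
        ρ 1 ^ (2 * Q * triangle r + triangle (2 * a)) ⊠ (fact (2 * Q) ^ r ⊠ M)
          ≈⟨ sym (lucasFact-value (2 * Q) (2 * a) (<⇒≤ 2a<r)) ⟩
        ⟪ lucasFact r (2 * a + 2 * Q * r) ⟫
          ≈⟨ reflexive (≡.cong (⟪_⟫ ∘ lucasFact r) (≡.sym double-m)) ⟩
        ⟪ lucasFact r (2 * m) ⟫
          ∎
        where
        m k n e : ℕ
        m = a + Q * r
        n = suc (2 * a)
        k = r ∸ n
        e = Q * triangle r + triangle a
        s₀ sa se M Gk Cn fr F₁ Fa : Carrier
        s₀ = ρ 1 ^ (triangle a + triangle a)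
        sa = ρ 1 ^ a
        se = ρ 1 ^ e
        M  = F (suc (2 * Q)) ^ (2 * a)
        Gk = ⟪ fibonomial Q Q ⟫ ^ k
        Cn = ⟪ fibCatalan Q ⟫ ^ n
        fr = fact Q ^ r
        F₁ = F (suc Q)
        Fa = F₁ ^ a
        a<r : a < r
        a<r = ≤-<-trans (m≤m+n a (a + 0)) 2a<r
        r≡k+n : r ≡ k + n
        r≡k+n = ≡.sym (m∸n+n≡m 2a<r)
        double-m : 2 * m ≡ 2 * a + 2 * Q * r
        double-m = ≡.trans (*-distribˡ-+ 2 a (Q * r)) (≡.cong (2 * a +_) (≡.sym (ℕ.*-assoc 2 Q r)))
        L-value : ⟪ lucasFact r m ⟫ ≈ se ⊠ (fr ⊠ Fa)
        L-value = lucasFact-value Q a (<⇒≤ a<r)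
        F₁ⁿ : F₁ ^ n ≈ F₁ ⊠ (Fa ⊠ Fa)
        F₁ⁿ = *-congˡ (trans (^-congʳ F₁ (≡.cong (a +_) (ℕ.+-identityʳ a))) (^-homo-* F₁ a a))
        fact2Q^r : fact (2 * Q) ^ r ≈ (Gk ⊠ Cn) ⊠ (fr ⊠ fr) ⊠ (F₁ ⊠ (Fa ⊠ Fa))
        fact2Q^r = begin
          fact (2 * Q) ^ r
            ≈⟨ ^-congʳ _ r≡k+n ⟩
          fact (2 * Q) ^ (k + n)
            ≈⟨ fibFact-double-power Q k n ⟩
          (Gk ⊠ Cn) ⊠ (fact Q ^ (k + n) ⊠ fact Q ^ (k + n)) ⊠ F₁ ^ n
            ≈⟨ *-cong (*-congˡ (*-cong (^-congʳ _ (≡.sym r≡k+n)) (^-congʳ _ (≡.sym r≡k+n)))) F₁ⁿ ⟩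
          (Gk ⊠ Cn) ⊠ (fr ⊠ fr) ⊠ (F₁ ⊠ (Fa ⊠ Fa))
            ∎

theorem6p1 : (r : ℕ) → .{{_ : NonZero r}} → (m : ℕ) → 2 * (m % r) < r →
    Σ Expr (λ P → (R : CommutativeRing 0ℓ 0ℓ) → (ρ : ℕ → CommutativeRing.Carrier R) →
      CommutativeRing._≈_ R
        (⟦ P ⊗ (lucas r (suc m) ⊗ (lucasFact r m ⊗ lucasFact r m)) ⟧ R ρ)
        (⟦ lucasFact r (2 * m) ⟧ R ρ))
theorem6p1 r@(suc r-1) m 2a<r =
  quotientWitness r (m % r) (m / r) , λ R ρ →
    LucasEvaluation.quotientWitness-spec R ρ r-1 (m % r) (m / r) (m≡m%n+[m/n]*n m r) 2a<r
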